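{- For all terms $s,t :: \sigma \Rightarrow \tau$ and $u,v :: \sigma$: if $s \sqsupset t$ and $u \sqsupseteq v$, then $s\ u \sqsupset t\ v$.
   Context: Simply typed terms: there is a single base type (sort) $\iota$; types are $\iota$ and $\sigma \Rightarrow \tau$. Given a set of typed variables (infinitely many of each type) and a possibly infinite set of typed function symbols, terms are built from variables and function symbols by type-respecting application: if $s :: \sigma \Rightarrow \tau$ and $t :: \sigma$ then $s\ t :: \tau$ (left-associative). Every term has the form $a\ s_1 \cdots s_n$ ($n\ge 0$) with $a$ a variable or function symbol. Fixed data: a precedence $\unrhd$ (a quasi-ordering on function symbols whose strict part $\rhd$ is well-founded; $\equiv$ denotes $\unrhd \cap \unlhd$), and a filter $\pi$ assigning to each $\mathsf{f} :: \sigma_1 \Rightarrow \dots \Rightarrow \sigma_m \Rightarrow \iota$ a set $\pi(\mathsf{f}) \subseteq \{1,\dots,m\}$; for each $\mathsf{f}$ the arities of the symbols $\mathsf{g} \equiv \mathsf{f}$ are bounded. Equivalence: $s \approx t$ iff $s,t$ have the same type and either (Eq-mono) $s = x\ s_1 \cdots s_n$, $t = x\ t_1 \cdots t_n$, $x$ a variable, $s_i \approx t_i$ for all $i$; or (Eq-args) $s = \mathsf{f}\ s_1 \cdots s_n$, $t = \mathsf{g}\ t_1 \cdots t_n$, $\mathsf{f},\mathsf{g}$ function symbols of the same type, $\mathsf{f} \equiv \mathsf{g}$, $\pi(\mathsf{f}) = \pi(\mathsf{g})$, $s_i \approx t_i$ for all $i \in \pi(\mathsf{f}) \cap \{1,\dots,n\}$.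 The relations $\sqsupseteq, \sqsupset, \sqsupset\!\!\sqsupset$ are the least relations such that: $s \sqsupseteq t$ iff $s \approx t$ or $s \sqsupset t$. $s \sqsupset t$ if $s,t$ have the same type and one of: (Gr-mono) $s = x\ s_1 \cdots s_n$, $t = x\ t_1 \cdots t_n$, $x$ a variable, $s_i \sqsupseteq t_i$ for all $i$ and $s_i \sqsupset t_i$ for some $i$; (Gr-args) $s = \mathsf{f}\ s_1 \cdots s_n$, $t = \mathsf{g}\ t_1 \cdots t_n$, $\mathsf{f},\mathsf{g}$ of the same type, $\mathsf{f} \equiv \mathsf{g}$, $\pi(\mathsf{f}) = \pi(\mathsf{g})$, $s_i \sqsupseteq t_i$ for all $i \in \pi(\mathsf{f}) \cap \{1,\dots,n\}$ and $s_i \sqsupset t_i$ for some such $i$; (Gr-rpo) $s \sqsupset\!\!\sqsupset t$. $s \sqsupset\!\!\sqsupset t$ ($s,t$ possibly of different types) if $s = \mathsf{f}\ s_1 \cdots s_n$ with $\mathsf{f} :: \sigma_1 \Rightarrow \dots \Rightarrow \sigma_m \Rightarrow \iota$, $\{n+1,\dots,m\} \subseteq \pi(\mathsf{f})$, and one of: (Rpo-select) $s_i \sqsupseteq t$ for some $i \in \pi(\mathsf{f}) \cap \{1,\dots,n\}$; (Rpo-appl) $t = t_0\ t_1 \cdots t_k$ with $k \ge 1$ and $s \sqsupset\!\!\sqsupset t_i$ for all $0 \le i \le k$; (Rpo-copy) $t = \mathsf{g}\ t_1 \cdots t_k$ with $\mathsf{f} \rhd \mathsf{g}$ and $s \sqsupset\!\!\sqsupset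 t_i$ for all $i \in \pi(\mathsf{g}) \cap \{1,\dots,k\}$; (Rpo-lex) $t = \mathsf{g}\ t_1 \cdots t_k$ with $\mathsf{f} \equiv \mathsf{g}$ and there is $i \in \pi(\mathsf{f}) \cap \pi(\mathsf{g}) \cap \{1,\dots,\min(n,k)\}$ with $\pi(\mathsf{f}) \cap \{1,\dots,i\} = \pi(\mathsf{g}) \cap \{1,\dots,i\}$, $s_j \approx t_j$ for all $j \in \{1,\dots,i-1\} \cap \pi(\mathsf{f})$, $s_i \sqsupset t_i$, and $s \sqsupset\!\!\sqsupset t_j$ for all $j \in \{i+1,\dots,k\} \cap \pi(\mathsf{g})$. -}

module Defs where

open import Data.Nat using (ℕ; zero; suc; _≤_; _<_; _⊔_)
open import Data.Bool using (Bool; true; false)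
open import Data.List using (List; []; _∷_; _++_; length; [_])
open import Data.Product using (Σ; ∃; _×_; _,_)
open import Data.Sum using (_⊎_)
open import Relation.Nullary using (¬_)
open import Relation.Binary.PropositionalEquality using (_≡_)
open import Relation.Binary.Structures using (IsPreorder)
open import Induction.WellFounded using (WellFounded)

infixr 5 _⇒_
data Ty : Set where
  ι   : Ty
  _⇒_ : Ty → Ty → Ty

arity : Ty → ℕ
arity ι       = 0
arity (σ ⇒ τ) = suc (arity τ)

record Setting : Set₁ where
  field
    Sym      : Set
    symTy    : Sym → Ty
    _⊵_      : Sym → Sym → Set
    ⊵-preorder : IsPreorder _≡_ _⊵_
  _≡ₚ_ : Sym → Sym → Set
  f ≡ₚ g = (f ⊵ g) × (g ⊵ f)
  _▷_ : Sym → Sym → Set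
  f ▷ g = (f ⊵ g) × ¬ (g ⊵ f)
  field
    ▷-wf     : WellFounded (λ g f → f ▷ g)
    -- π f i ≡ true  means  i ∈ π(f)   (positions are 1-based)
    π        : Sym → ℕ → Bool
    π-range  : ∀ f i → π f i ≡ true → 1 ≤ i × i ≤ arity (symTy f)
    arity-bounded : ∀ f → ∃ λ B → ∀ g → f ≡ₚ g → arity (symTy g) ≤ B

module Terms (S : Setting) where
  open Setting S

  data Head : Set where
    var : ℕ → Ty → Head
    fun : Sym → Head

  headTy : Head → Ty
  headTy (var _ σ) = σ
  headTy (fun f)   = symTy f

  -- raw terms in head–spine form  a s₁ ⋯ sₙ
  data Tm : Set where
    tm : Head → List Tm → Tm

  mutual
    data _∶_ : Tm → Ty → Set where
      tm-ty : ∀ {a ss τ} → SpTy (headTy a) ss τ → tm a ss ∶ τ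

    -- SpTy σ ss τ : applying something of type σ to ss yields type τ
    data SpTy : Ty → List Tm → Ty → Set where
      sp-[] : ∀ {σ} → SpTy σ [] σ
      sp-∷  : ∀ {σ τ ρ s ss} → s ∶ σ → SpTy τ ss ρ → SpTy (σ ⇒ τ) (s ∷ ss) ρ

  SameTy : Tm → Tm → Set
  SameTy s t = Σ Ty λ σ → (s ∶ σ) × (t ∶ σ)

  _·_ : Tm → Tm → Tm
  tm a ss · u = tm a (ss ++ [ u ])

  -- Arg ss i s : the i-th element (1-based) of ss is s
  data Arg : List Tm → ℕ → Tm → Set where
    here  : ∀ {s ss} → Arg (s ∷ ss) 1 s
    there : ∀ {s ss i t} → Arg ss i t → Arg (s ∷ ss) (suc i) t

  Filled : Sym → List Tm → Set
  Filled f ss = ∀ i → length ss < i → i ≤ arity (symTy f) → π f i ≡ true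

  SameFilter : Sym → Sym → Set
  SameFilter f g = ∀ i → π f i ≡ π g i

  infix 4 _≈_ _⊒_ _⊐_ _⊐⊐_

  data _≈_ : Tm → Tm → Set where
    eq-mono : ∀ {x σ ss ts} → SameTy (tm (var x σ) ss) (tm (var x σ) ts) →
              length ss ≡ length ts →
              (∀ i s' t' → Arg ss i s' → Arg ts i t' → s' ≈ t') →
              tm (var x σ) ss ≈ tm (var x σ) ts
    eq-args : ∀ {f g ss ts} → SameTy (tm (fun f) ss) (tm (fun g) ts) →
              symTy f ≡ symTy g → f ≡ₚ g → SameFilter f g →
              length ss ≡ length ts →
              (∀ i s' t' → π f i ≡ true → Arg ss i s' → Arg ts i t' → s' ≈ t') →
              tm (fun f) ss ≈ tm (fun g) ts

  mutual
    data _⊒_ : Tm → Tm → Set where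
      ge-eq : ∀ {s t} → s ≈ t → s ⊒ t
      ge-gr : ∀ {s t} → s ⊐ t → s ⊒ t

    data _⊐_ : Tm → Tm → Set where
      gr-mono : ∀ {x σ ss ts} → SameTy (tm (var x σ) ss) (tm (var x σ) ts) →
                length ss ≡ length ts →
                (∀ i s' t' → Arg ss i s' → Arg ts i t' → s' ⊒ t') →
                (∃ λ i → Σ Tm λ s' → Σ Tm λ t' → Arg ss i s' × Arg ts i t' × s' ⊐ t') →
                tm (var x σ) ss ⊐ tm (var x σ) ts
      gr-args : ∀ {f g ss ts} → SameTy (tm (fun f) ss) (tm (fun g) ts) →
                symTy f ≡ symTy g → f ≡ₚ g → SameFilter f g →
                length ss ≡ length ts →
                (∀ i s' t' → π f i ≡ true → Arg ss i s' → Arg ts i t' → s' ⊒ t') →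
                (∃ λ i → Σ Tm λ s' → Σ Tm λ t' →
                   π f i ≡ true × Arg ss i s' × Arg ts i t' × s' ⊐ t') →
                tm (fun f) ss ⊐ tm (fun g) ts
      gr-rpo  : ∀ {s t} → SameTy s t → s ⊐⊐ t → s ⊐ t

    data _⊐⊐_ : Tm → Tm → Set where
      rpo-select : ∀ {f ss t} → Filled f ss →
                   ∀ i s' → π f i ≡ true → Arg ss i s' → s' ⊒ t →
                   tm (fun f) ss ⊐⊐ t
      -- t = t₀ t₁ ⋯ tₖ (k ≥ 1) where t₀ = a ts₀ and ts₁ = t₁ ⋯ tₖ
      rpo-appl   : ∀ {f ss a ts₀ t₁ ts₁} → Filled f ss →
                   tm (fun f) ss ⊐⊐ tm a ts₀ →
                   (∀ i u → Arg (t₁ ∷ ts₁) i u → tm (fun f) ss ⊐⊐ u) →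
                   tm (fun f) ss ⊐⊐ tm a (ts₀ ++ (t₁ ∷ ts₁))
      rpo-copy   : ∀ {f ss g ts} → Filled f ss → f ▷ g →
                   (∀ i u → π g i ≡ true → Arg ts i u → tm (fun f) ss ⊐⊐ u) →
                   tm (fun f) ss ⊐⊐ tm (fun g) ts
      rpo-lex    : ∀ {f ss g ts} → Filled f ss → f ≡ₚ g →
                   ∀ i sᵢ tᵢ → π f i ≡ true → π g i ≡ true →
                   Arg ss i sᵢ → Arg ts i tᵢ →
                   (∀ j → j ≤ i → π f j ≡ π g j) →
                   (∀ j s' t' → j < i → π f j ≡ true →
                      Arg ss j s' → Arg ts j t' → s' ≈ t') →
                   sᵢ ⊐ tᵢ →
                   (∀ j u → i < j → π g j ≡ true → Arg ts j u → tm (fun f) ss ⊐⊐ u) →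
                   tm (fun f) ss ⊐⊐ tm (fun g) ts

{-# OPTIONS --safe #-}
module Submission where

-- Appending u and v keeps a Gr-mono or Gr-args step monotonic, with u ⊒ v as
-- the new argument pair. A step s ⊐⊐ t becomes an Rpo-appl step s u ⊐⊐ t v:
-- every ⊐⊐ rule survives adding an argument on the left, so s u ⊐⊐ t, and
-- s u ⊐⊐ v by Rpo-select on u, whose position n+1 lies in π(f) because s has
-- an arrow type (so n+1 ≤ m) and s ⊐⊐ t already requires {n+1,…,m} ⊆ π(f).

open import Defs
open import Data.Nat using (suc; _≤_; _<_; z≤n; s≤s)
open import Data.Nat.Properties using (<⇒≤; 1+n≰n; n<1+n; <-≤-trans)
open import Data.Bool using (true)
open import Data.List using (List; []; _∷_; _++_; length; [_])
open import Data.List.Properties using (length-++-comm)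
open import Data.Product using (_×_; _,_)
open import Data.Sum using (_⊎_; inj₁; inj₂)
open import Data.Empty using (⊥-elim)
open import Relation.Binary.PropositionalEquality using (_≡_; refl; cong; sym; trans; subst)

module _ (S : Setting) where
  open Setting S
  open Terms S

  SpTy-snoc : ∀ {ρ ss σ τ u} → SpTy ρ ss (σ ⇒ τ) → u ∶ σ → SpTy ρ (ss ++ [ u ]) τ
  SpTy-snoc sp-[]        ⊢u = sp-∷ ⊢u sp-[]
  SpTy-snoc (sp-∷ ⊢s sp) ⊢u = sp-∷ ⊢s (SpTy-snoc sp ⊢u)

  ·-typed : ∀ {s u σ τ} → s ∶ (σ ⇒ τ) → u ∶ σ → (s · u) ∶ τ
  ·-typed {tm _ _} (tm-ty sp) ⊢u = tm-ty (SpTy-snoc sp ⊢u)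

  SpTy-⇒-length<arity : ∀ {ρ ss σ τ} → SpTy ρ ss (σ ⇒ τ) → length ss < arity ρ
  SpTy-⇒-length<arity sp-[]       = s≤s z≤n
  SpTy-⇒-length<arity (sp-∷ _ sp) = s≤s (SpTy-⇒-length<arity sp)

  length-snoc : ∀ (ss : List Tm) u → length (ss ++ [ u ]) ≡ suc (length ss)
  length-snoc ss u = length-++-comm ss [ u ]

  Arg⇒≤length : ∀ {ss i s} → Arg ss i s → i ≤ length ss
  Arg⇒≤length here      = s≤s z≤n
  Arg⇒≤length (there a) = s≤s (Arg⇒≤length a)

  Arg-snoc⁺ : ∀ {ss i s u} → Arg ss i s → Arg (ss ++ [ u ]) i s
  Arg-snoc⁺ here      = here
  Arg-snoc⁺ (there a) = there (Arg-snoc⁺ a)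

  Arg-snoc-last : ∀ (ss : List Tm) u → Arg (ss ++ [ u ]) (suc (length ss)) u
  Arg-snoc-last []       u = here
  Arg-snoc-last (_ ∷ ss) u = there (Arg-snoc-last ss u)

  Arg-snoc⁻ : ∀ {ss i s u} → Arg (ss ++ [ u ]) i s →
              Arg ss i s ⊎ (i ≡ suc (length ss) × s ≡ u)
  Arg-snoc⁻ {[]}     here        = inj₂ (refl , refl)
  Arg-snoc⁻ {_ ∷ _}  here        = inj₁ here
  Arg-snoc⁻ {_ ∷ ss} (there a) with Arg-snoc⁻ {ss} a
  ... | inj₁ b             = inj₁ (there b)
  ... | inj₂ (refl , s≡u)  = inj₂ (refl , s≡u)

  Arg-snoc⁻-≤length : ∀ {ss i s u} → Arg (ss ++ [ u ]) i s → i ≤ length ss → Arg ss i s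
  Arg-snoc⁻-≤length {ss} a i≤ with Arg-snoc⁻ {ss} a
  ... | inj₁ b          = b
  ... | inj₂ (refl , _) = ⊥-elim (1+n≰n i≤)

  snoc-pointwise : ∀ {R : Tm → Tm → Set} {ss ts u v i s t} → length ss ≡ length ts →
                   (∀ {s' t'} → Arg ss i s' → Arg ts i t' → R s' t') → R u v →
                   Arg (ss ++ [ u ]) i s → Arg (ts ++ [ v ]) i t → R s t
  snoc-pointwise {ss = ss} {ts} ss≡ts R-args Ruv a b with Arg-snoc⁻ {ss} a | Arg-snoc⁻ {ts} b
  ... | inj₁ a'          | inj₁ b'          = R-args a' b'
  ... | inj₁ a'          | inj₂ (refl , _) = ⊥-elim (1+n≰n (subst (_ ≤_) ss≡ts (Arg⇒≤length a')))
  ... | inj₂ (refl , _) | inj₁ b'          = ⊥-elim (1+n≰n (subst (_ ≤_) (sym ss≡ts) (Arg⇒≤length b')))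
  ... | inj₂ (_ , refl) | inj₂ (_ , refl) = Ruv

  length-snoc-≡ : ∀ (ss ts : List Tm) u v → length ss ≡ length ts →
                  length (ss ++ [ u ]) ≡ length (ts ++ [ v ])
  length-snoc-≡ ss ts u v ss≡ts =
    trans (length-snoc ss u) (trans (cong suc ss≡ts) (sym (length-snoc ts v)))

  Filled-snoc : ∀ f ss u → Filled f ss → Filled f (ss ++ [ u ])
  Filled-snoc f ss u filled i len< i≤ =
    filled i (<⇒≤ (subst (_< i) (length-snoc ss u) len<)) i≤

  ⊐⊐⇒Filled : ∀ {f ss t} → tm (fun f) ss ⊐⊐ t → Filled f ss
  ⊐⊐⇒Filled (rpo-select filled _ _ _ _ _)             = filled
  ⊐⊐⇒Filled (rpo-appl filled _ _)                     = filled
  ⊐⊐⇒Filled (rpo-copy filled _ _)                     = filled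
  ⊐⊐⇒Filled (rpo-lex filled _ _ _ _ _ _ _ _ _ _ _ _) = filled

  ⊐⊐-snocˡ : ∀ {f ss u t} → tm (fun f) ss ⊐⊐ t → tm (fun f) (ss ++ [ u ]) ⊐⊐ t
  ⊐⊐-snocˡ {f} {ss} {u} (rpo-select filled i s p a s⊒t) =
    rpo-select (Filled-snoc f ss u filled) i s p (Arg-snoc⁺ a) s⊒t
  ⊐⊐-snocˡ {f} {ss} {u} (rpo-appl filled r rs) =
    rpo-appl (Filled-snoc f ss u filled) (⊐⊐-snocˡ r) (λ i w a → ⊐⊐-snocˡ (rs i w a))
  ⊐⊐-snocˡ {f} {ss} {u} (rpo-copy filled f▷g rs) =
    rpo-copy (Filled-snoc f ss u filled) f▷g (λ i w p a → ⊐⊐-snocˡ (rs i w p a))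
  ⊐⊐-snocˡ {f} {ss} {u} (rpo-lex filled f≡g i sᵢ tᵢ pf pg aᵢ bᵢ π≡ ≈-before sᵢ⊐tᵢ rs) =
    rpo-lex (Filled-snoc f ss u filled) f≡g i sᵢ tᵢ pf pg (Arg-snoc⁺ aᵢ) bᵢ π≡
      (λ j s t j<i p a b → ≈-before j s t j<i p
         (Arg-snoc⁻-≤length a (<⇒≤ (<-≤-trans j<i (Arg⇒≤length aᵢ)))) b)
      sᵢ⊐tᵢ (λ j w i<j p b → ⊐⊐-snocˡ (rs j w i<j p b))

  ⊐⊐-· : ∀ {f ss σ τ b ts u v} → SpTy (symTy f) ss (σ ⇒ τ) →
         tm (fun f) ss ⊐⊐ tm b ts → u ⊒ v →
         tm (fun f) ss · u ⊐⊐ tm b ts · v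
  ⊐⊐-· {f} {ss} {u = u} sp r u⊒v =
    rpo-appl filled (⊐⊐-snocˡ r) λ where
      _ _ here → rpo-select filled (suc (length ss)) u next∈π (Arg-snoc-last ss u) u⊒v
    where
      filled : Filled f (ss ++ [ u ])
      filled = Filled-snoc f ss u (⊐⊐⇒Filled r)
      next∈π : π f (suc (length ss)) ≡ true
      next∈π = ⊐⊐⇒Filled r (suc (length ss)) (n<1+n _) (SpTy-⇒-length<arity sp)

  ·-mono-⊐ : ∀ (σ τ : Ty) (s t u v : Tm) →
             s ∶ (σ ⇒ τ) → t ∶ (σ ⇒ τ) → u ∶ σ → v ∶ σ →
             s ⊐ t → u ⊒ v → (s · u) ⊐ (t · v)
  ·-mono-⊐ σ τ (tm _ ss) (tm _ ts) u v ⊢s ⊢t ⊢u ⊢v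
           (gr-mono _ ss≡ts ⊒-args (i , s' , t' , a , b , s'⊐t')) u⊒v =
    gr-mono (τ , ·-typed ⊢s ⊢u , ·-typed ⊢t ⊢v) (length-snoc-≡ ss ts u v ss≡ts)
      (λ i _ _ → snoc-pointwise ss≡ts (⊒-args i _ _) u⊒v)
      (i , s' , t' , Arg-snoc⁺ a , Arg-snoc⁺ b , s'⊐t')
  ·-mono-⊐ σ τ (tm _ ss) (tm _ ts) u v ⊢s ⊢t ⊢u ⊢v
           (gr-args _ f∶g f≡g π≡ ss≡ts ⊒-args (i , s' , t' , p , a , b , s'⊐t')) u⊒v =
    gr-args (τ , ·-typed ⊢s ⊢u , ·-typed ⊢t ⊢v) f∶g f≡g π≡ (length-snoc-≡ ss ts u v ss≡ts)
      (λ i _ _ p → snoc-pointwise ss≡ts (⊒-args i _ _ p) u⊒v)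
      (i , s' , t' , p , Arg-snoc⁺ a , Arg-snoc⁺ b , s'⊐t')
  ·-mono-⊐ σ τ (tm (fun f) ss) (tm _ ts) u v (tm-ty sp) ⊢t ⊢u ⊢v (gr-rpo _ r) u⊒v =
    gr-rpo (τ , ·-typed (tm-ty sp) ⊢u , ·-typed ⊢t ⊢v) (⊐⊐-· sp r u⊒v)

lemma6 : (S : Setting) → let open Terms S in
           ∀ (σ τ : Ty) (s t u v : Tm) →
             s ∶ (σ ⇒ τ) → t ∶ (σ ⇒ τ) → u ∶ σ → v ∶ σ →
             s ⊐ t → u ⊒ v → (s · u) ⊐ (t · v)
lemma6 = ·-mono-⊐
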